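{- Let $q\ge3$ be an odd integer. Define $g(n)=f_{2,q}(qn-1)$ for integers $n\ge1$, and let $h$ be the function on positive integers defined by $h(j)=j$ for $1\le j\le q$ and, for $n\ge q$, $$h(n+1)=\begin{cases}h(n)+1,&\text{if } q\nmid n;\\[2pt] h(n)\Big(1-\dfrac{1}{h(\frac{n}{q}+1)}\Big)+1,&\text{if } q\mid n.\end{cases}$$ Then for every integer $n\ge1$, $$g(n)\ge h(n)\,g\Big(\Big\lceil\frac{n}{q}\Big\rceil\Big).$$
   Context: $\mathbb{N}$ denotes the set of nonnegative integers. $f_{2,q}(n)$ denotes the number of different expressions of the positive integer $n$ as a sum of distinct terms taken from $\{2^{\alpha}q^{\beta}:\alpha,\beta\in\mathbb{N}\}$ (i.e. the number of finite subsets of this set whose elements sum to $n$). $\lceil x\rceil$ denotes the least integer $\ge x$. (In the paper, $g(n)$ is defined as the common value $f_{2,q}(qn-1)=f_{2,q}(qn-2)=\cdots=f_{2,q}(qn-q)$; in particular $g(1)=1$.) -}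

module Defs where

open import Data.Nat as ℕ using (ℕ; zero; suc; _+_; _*_; _∸_; _^_; _≤?_)
open import Data.Nat.DivMod using (_/_)
open import Data.Nat.Divisibility using (_∣?_; quotient)
open import Data.List using (List; []; _∷_; _++_; map; filter; length; upTo; _∷ʳ_)
open import Data.Nat.ListAction using (sum)
open import Data.List.Relation.Unary.Any using (Any; any?)
open import Data.Rational using (ℚ; 0ℚ; 1ℚ; _-_; 1/_; ≢-nonZero) renaming (_+_ to _+ℚ_; _*_ to _*ℚ_)
open import Data.Rational.Properties using (_≟_)
import Data.Integer as ℤ
open import Relation.Nullary using (Dec; yes; no)
open import Relation.Binary.PropositionalEquality using (_≡_)

ℕtoℚ : ℕ → ℚ
ℕtoℚ n = ℤ.+ n Data.Rational./ 1

-- m = 2^a q^b for some a, b.  The search over a, b ≤ m is exhaustive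
-- (2^a > a, and q^b > b for q ≥ 2), so this is exactly membership.
IsTerm : ℕ → ℕ → Set
IsTerm q m = Any (λ a → Any (λ b → 2 ^ a * q ^ b ≡ m) (upTo (suc m))) (upTo (suc m))

isTerm? : (q m : ℕ) → Dec (IsTerm q m)
isTerm? q m = any? (λ a → any? (λ b → 2 ^ a * q ^ b ℕ.≟ m) (upTo (suc m))) (upTo (suc m))

termsUpTo : ℕ → ℕ → List ℕ
termsUpTo q n = filter (isTerm? q) (upTo (suc n))

subsets : {A : Set} → List A → List (List A)
subsets []       = [] ∷ []
subsets (x ∷ xs) = subsets xs ++ map (x ∷_) (subsets xs)

-- f_{2,q}(n): number of finite subsets of {2^α q^β} whose elements sum to n
-- (only elements ≤ n can occur in such a subset)
f : ℕ → ℕ → ℕ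
f q n = length (filter (λ s → sum s ℕ.≟ n) (subsets (termsUpTo q n)))

g : ℕ → ℕ → ℕ
g q n = f q (q * n ∸ 1)

-- ⌈ n / q ⌉  (junk value 0 when q = 0)
⌈_/_⌉ : ℕ → ℕ → ℕ
⌈ n / zero ⌉  = 0
⌈ n / suc k ⌉ = (n + k) / suc k

at : List ℚ → ℕ → ℚ
at []       _       = 0ℚ
at (x ∷ xs) zero    = x
at (x ∷ xs) (suc i) = at xs i

-- 1/x, with junk value 0 at x = 0 (never used: h takes positive values)
inv : ℚ → ℚ
inv x with x ≟ 0ℚ
... | yes _  = 0ℚ
... | no x≢0 = 1/_ x {{≢-nonZero x≢0}}

-- value of h(n+1) given the table t = [h(1), …, h(n)]
hStep : ℕ → ℕ → List ℚ → ℚ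
hStep q n t with suc n ≤? q
... | yes _ = ℕtoℚ (suc n)
... | no  _ with q ∣? n
...   | no  _   = at t (n ∸ 1) +ℚ 1ℚ
...   | yes q∣n = at t (n ∸ 1) *ℚ (1ℚ - inv (at t (quotient q∣n))) +ℚ 1ℚ
                                              -- h(n)(1 - 1/h(n/q + 1)) + 1

hTable : ℕ → ℕ → List ℚ
hTable q zero    = []
hTable q (suc n) = hTable q n ∷ʳ hStep q n (hTable q n)

h : ℕ → ℕ → ℚ
h q n = at (hTable q n) (n ∸ 1)

{-# OPTIONS --safe #-}
-- Let T = {2^α q^β} and Σ f(n) X^n = Π_{t ∈ T} (1 + X^t) =: F(X). As q is odd, T is the disjoint
-- union of the powers of two and qT, so by uniqueness of binary expansions F(X) = F(X^q) / (1 - X),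
-- i.e. f(n+1) = f(n) + [q ∣ n+1] f((n+1)/q); truncated products suffice, since parts larger than n
-- do not affect the coefficient of X^n. Hence f is constant on the blocks [iq, iq + q), so that
-- g(n+1) = f(nq) and g(n+1) = g(n) + g(⌈(n+1)/q⌉) for n ≥ 1. From this recurrence, strong induction
-- gives the claim with equality, h(n) g(⌈n/q⌉) = g(n): if q ∤ n both sides grow by g(⌈n/q⌉), and
-- if n = mq the factor 1 - 1/h(m+1) turns g(m+1) = h(m+1) g(⌈(m+1)/q⌉) into g(m+1) - g(⌈(m+1)/q⌉) = g(m).

module Submission where

open import Defs
open import Data.Bool using (Bool; true; false; if_then_else_; _∧_; not)
open import Data.Bool.Properties using (¬-not; ∧-identityʳ; ∧-zeroʳ)
import Data.Integer as ℤ
import Data.Integer.Properties as ℤ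
open import Data.List using (List; []; _∷_; _++_; _∷ʳ_; map; filter; length; upTo)
open import Data.List.Properties using (filter-++; length-++; ++-identityʳ; upTo-∷ʳ)
open import Data.List.Relation.Unary.Any.Properties using (applyUpTo⁺; applyUpTo⁻)
open import Data.Nat
open import Data.Nat.Coprimality as Coprimality using (Coprime; coprime-divisor)
open import Data.Nat.DivMod
open import Data.Nat.Divisibility
open import Data.Nat.Induction using (<-rec)
open import Data.Nat.ListAction using (sum)
open import Data.Nat.Properties
open import Algebra.Properties.CommutativeSemigroup +-commutativeSemigroup using (interchange)
open import Data.Product using (∃-syntax; ∃₂; _,_)
open import Data.Rational using (ℚ; 0ℚ; 1ℚ; _-_; mkℚ) renaming (_+_ to _+ℚ_; _*_ to _*ℚ_; _/_ to _/ℚ_; _≤_ to _≤ℚ_)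
import Data.Rational as ℚ using (≢-nonZero)
import Data.Rational.Properties as ℚ
open import Data.Rational.Solver using (module +-*-Solver)
open import Data.Sum using (inj₁; inj₂)
open import Function using (_∘_; id; case_of_; _⇔_; mk⇔)
open import Relation.Binary.PropositionalEquality
open import Relation.Nullary using (Dec; yes; no; ¬_; does)
open import Relation.Nullary.Decidable using (dec-true; dec-false; does-⇔)
open import Relation.Nullary.Negation using (contradiction)
open import Relation.Unary using (Decidable)

-- Formal power series over ℕ as coefficient sequences: shift x multiplies by X^x,
-- addPart x by 1 + X^x, and _⋆_ is the Cauchy product.
Series : Set
Series = ℕ → ℕ

δ₀ : Series
δ₀ zero    = 1
δ₀ (suc _) = 0

ones : Series
ones _ = 1

infixl 6 _⊕_
infixl 7 _⋆_

_⊕_ : Series → Series → Series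
(a ⊕ b) n = a n + b n

shift : ℕ → Series → Series
shift zero    a n       = a n
shift (suc x) a zero    = 0
shift (suc x) a (suc n) = shift x a n

addPart : ℕ → Series → Series
addPart x a = a ⊕ shift x a

_⋆_ : Series → Series → Series
(a ⋆ b) zero    = a 0 * b 0
(a ⋆ b) (suc n) = a 0 * b (suc n) + (a ∘ suc ⋆ b) n

shift-cong : ∀ x {a b} → a ≗ b → shift x a ≗ shift x b
shift-cong zero    a≗b n       = a≗b n
shift-cong (suc x) a≗b zero    = refl
shift-cong (suc x) a≗b (suc n) = shift-cong x a≗b n

shift-⊕ : ∀ x a b → shift x (a ⊕ b) ≗ shift x a ⊕ shift x b
shift-⊕ zero    a b n       = refl
shift-⊕ (suc x) a b zero    = refl
shift-⊕ (suc x) a b (suc n) = shift-⊕ x a b n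

shift-shift : ∀ x y a → shift x (shift y a) ≗ shift (x + y) a
shift-shift zero    y a n       = refl
shift-shift (suc x) y a zero    = refl
shift-shift (suc x) y a (suc n) = shift-shift x y a n

shift-≥ : ∀ {x n} a → x ≤ n → shift x a n ≡ a (n ∸ x)
shift-≥ {zero}  a _         = refl
shift-≥ {suc x} a (s≤s x≤n) = shift-≥ a x≤n

shift-< : ∀ {x n} a → n < x → shift x a n ≡ 0
shift-< {suc x} {zero}  a _         = refl
shift-< {suc x} {suc n} a (s≤s n<x) = shift-< a n<x

shift-0 : ∀ x → shift x (λ _ → 0) ≗ (λ _ → 0)
shift-0 zero    n       = refl
shift-0 (suc x) zero    = refl
shift-0 (suc x) (suc n) = shift-0 x n

addPart-cong : ∀ x {a b} → a ≗ b → addPart x a ≗ addPart x b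
addPart-cong x a≗b n = cong₂ _+_ (a≗b n) (shift-cong x a≗b n)

addPart-comm : ∀ x y a → addPart x (addPart y a) ≗ addPart y (addPart x a)
addPart-comm x y a n = begin
  addPart y a n + shift x (addPart y a) n               ≡⟨ cong (addPart y a n +_) (shift-addPart x y) ⟩
  a n + shift y a n + (shift x a n + shift (x + y) a n) ≡⟨ interchange (a n) _ _ _ ⟩
  a n + shift x a n + (shift y a n + shift (x + y) a n) ≡⟨ cong (λ z → addPart x a n + (shift y a n + shift z a n))
                                                                (+-comm x y) ⟩
  a n + shift x a n + (shift y a n + shift (y + x) a n) ≡⟨ cong (addPart x a n +_) (sym (shift-addPart y x)) ⟩
  addPart x a n + shift y (addPart x a) n               ∎
  where
  open ≡-Reasoning
  shift-addPart : ∀ u v → shift u (addPart v a) n ≡ shift u a n + shift (u + v) a n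
  shift-addPart u v = trans (shift-⊕ u a (shift v a) n) (cong (shift u a n +_) (shift-shift u v a n))

⋆-cong-≤ : ∀ {a a′ b b′} n → (∀ {k} → k ≤ n → a k ≡ a′ k) → (∀ {k} → k ≤ n → b k ≡ b′ k) →
           (a ⋆ b) n ≡ (a′ ⋆ b′) n
⋆-cong-≤ zero    a≡a′ b≡b′ = cong₂ _*_ (a≡a′ z≤n) (b≡b′ z≤n)
⋆-cong-≤ (suc n) a≡a′ b≡b′ =
  cong₂ _+_ (cong₂ _*_ (a≡a′ z≤n) (b≡b′ ≤-refl)) (⋆-cong-≤ n (a≡a′ ∘ s≤s) (b≡b′ ∘ m≤n⇒m≤1+n))

⋆-cong : ∀ {a a′ b b′} → a ≗ a′ → b ≗ b′ → a ⋆ b ≗ a′ ⋆ b′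
⋆-cong a≗a′ b≗b′ n = ⋆-cong-≤ n (λ {k} _ → a≗a′ k) (λ {k} _ → b≗b′ k)

zero-⋆ : ∀ b → (λ _ → 0) ⋆ b ≗ (λ _ → 0)
zero-⋆ b zero    = refl
zero-⋆ b (suc n) = zero-⋆ b n

δ₀-⋆ : ∀ b → δ₀ ⋆ b ≗ b
δ₀-⋆ b zero    = +-identityʳ (b 0)
δ₀-⋆ b (suc n) = trans (cong₂ _+_ (+-identityʳ (b (suc n))) (zero-⋆ b n)) (+-identityʳ (b (suc n)))

⋆-distribʳ-⊕ : ∀ a b c → (a ⊕ b) ⋆ c ≗ a ⋆ c ⊕ b ⋆ c
⋆-distribʳ-⊕ a b c zero    = *-distribʳ-+ (c 0) (a 0) (b 0)
⋆-distribʳ-⊕ a b c (suc n) =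
  trans (cong₂ _+_ (*-distribʳ-+ (c (suc n)) (a 0) (b 0)) (⋆-distribʳ-⊕ (a ∘ suc) (b ∘ suc) c n))
        (interchange (a 0 * c (suc n)) _ _ _)

⋆-distribˡ-⊕ : ∀ a b c → a ⋆ (b ⊕ c) ≗ a ⋆ b ⊕ a ⋆ c
⋆-distribˡ-⊕ a b c zero    = *-distribˡ-+ (a 0) (b 0) (c 0)
⋆-distribˡ-⊕ a b c (suc n) =
  trans (cong₂ _+_ (*-distribˡ-+ (a 0) (b (suc n)) (c (suc n))) (⋆-distribˡ-⊕ (a ∘ suc) b c n))
        (interchange (a 0 * b (suc n)) _ _ _)

shift-⋆ : ∀ x a b → shift x a ⋆ b ≗ shift x (a ⋆ b)
shift-⋆ zero    a b n       = refl
shift-⋆ (suc x) a b zero    = refl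
shift-⋆ (suc x) a b (suc n) = shift-⋆ x a b n

⋆-shift1 : ∀ a b → a ⋆ shift 1 b ≗ shift 1 (a ⋆ b)
⋆-shift1 a b zero          = *-zeroʳ (a 0)
⋆-shift1 a b (suc zero)    = trans (cong (a 0 * b 0 +_) (*-zeroʳ (a 1))) (+-identityʳ (a 0 * b 0))
⋆-shift1 a b (suc (suc n)) = cong (a 0 * b (suc n) +_) (⋆-shift1 (a ∘ suc) b (suc n))

⋆-shift : ∀ x a b → a ⋆ shift x b ≗ shift x (a ⋆ b)
⋆-shift zero    a b n = refl
⋆-shift (suc x) a b n = begin
  (a ⋆ shift (suc x) b) n        ≡⟨ ⋆-cong (λ _ → refl) (λ k → sym (shift-shift 1 x b k)) n ⟩
  (a ⋆ shift 1 (shift x b)) n    ≡⟨ ⋆-shift1 a (shift x b) n ⟩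
  shift 1 (a ⋆ shift x b) n      ≡⟨ shift-cong 1 (⋆-shift x a b) n ⟩
  shift 1 (shift x (a ⋆ b)) n    ≡⟨ shift-shift 1 x (a ⋆ b) n ⟩
  shift (suc x) (a ⋆ b) n        ∎
  where open ≡-Reasoning

addPart-⋆ : ∀ x a b → addPart x a ⋆ b ≗ addPart x (a ⋆ b)
addPart-⋆ x a b n = trans (⋆-distribʳ-⊕ a (shift x a) b n) (cong ((a ⋆ b) n +_) (shift-⋆ x a b n))

⋆-addPart : ∀ x a b → a ⋆ addPart x b ≗ addPart x (a ⋆ b)
⋆-addPart x a b n = trans (⋆-distribˡ-⊕ a b (shift x b) n) (cong ((a ⋆ b) n +_) (⋆-shift x a b n))

-- Π_{m < M, p m} (1 + X^m): the coefficient of X^n counts the sets of distinct parts m < M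
-- with p m that sum to n.
parts : (ℕ → Bool) → ℕ → Series
parts p zero    = δ₀
parts p (suc M) = if p M then addPart M (parts p M) else parts p M

parts-cong : ∀ {p p′} → p ≗ p′ → ∀ M → parts p M ≡ parts p′ M
parts-cong p≗p′ zero = refl
parts-cong p≗p′ (suc M) rewrite p≗p′ M | parts-cong p≗p′ M = refl

parts-split : ∀ (p d : ℕ → Bool) M →
              parts p M ≗ parts (λ m → p m ∧ not (d m)) M ⋆ parts (λ m → p m ∧ d m) M
parts-split p d zero n = sym (δ₀-⋆ δ₀ n)
parts-split p d (suc M) n with p M | d M
... | false | _     = parts-split p d M n
... | true  | false = trans (addPart-cong M (parts-split p d M) n) (sym (addPart-⋆ M _ _ n))
... | true  | true  = trans (addPart-cong M (parts-split p d M) n) (sym (⋆-addPart M _ _ n))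

parts-gap : ∀ {p M N} → M ≤′ N → (∀ {m} → M ≤ m → m < N → p m ≡ false) → parts p N ≡ parts p M
parts-gap ≤′-refl              _   = refl
parts-gap (≤′-step {N} M≤N) gap rewrite gap (≤′⇒≤ M≤N) (n<1+n N) =
  parts-gap M≤N (λ M≤m m<N → gap M≤m (m<n⇒m<1+n m<N))

parts-stable : ∀ p {n M N} → n < M → M ≤′ N → parts p N n ≡ parts p M n
parts-stable p n<M ≤′-refl = refl
parts-stable p {n} {M} n<M (≤′-step {N} M≤N) with p N
... | false = parts-stable p n<M M≤N
... | true  = begin
  parts p N n + shift N (parts p N) n ≡⟨ cong (parts p N n +_) (shift-< (parts p N) n<N) ⟩
  parts p N n + 0                     ≡⟨ +-identityʳ _ ⟩
  parts p N n                         ≡⟨ parts-stable p n<M M≤N ⟩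
  parts p M n                         ∎
  where
  open ≡-Reasoning
  n<N = <-≤-trans n<M (≤′⇒≤ M≤N)

shift-δ₀ : ∀ k n → shift k δ₀ n ≡ (if k ≡ᵇ n then 1 else 0)
shift-δ₀ zero    zero    = refl
shift-δ₀ zero    (suc n) = refl
shift-δ₀ (suc k) zero    = refl
shift-δ₀ (suc k) (suc n) = shift-δ₀ k n

sumCount : List (List ℕ) → Series
sumCount ss n = length (filter (λ s → sum s ≟ n) ss)

sumCount-∷ : ∀ s ss → sumCount (s ∷ ss) ≗ shift (sum s) δ₀ ⊕ sumCount ss
sumCount-∷ s ss n rewrite shift-δ₀ (sum s) n with sum s ≡ᵇ n
... | true  = refl
... | false = refl

sumCount-++ : ∀ ss ts → sumCount (ss ++ ts) ≗ sumCount ss ⊕ sumCount ts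
sumCount-++ ss ts n = trans (cong length (filter-++ (λ s → sum s ≟ n) ss ts)) (length-++ (filter _ ss))

sumCount-map-∷ : ∀ x ss → sumCount (map (x ∷_) ss) ≗ shift x (sumCount ss)
sumCount-map-∷ x []       n = sym (shift-0 x n)
sumCount-map-∷ x (s ∷ ss) n = begin
  sumCount (map (x ∷_) (s ∷ ss)) n                       ≡⟨ sumCount-∷ (x ∷ s) _ n ⟩
  shift (x + sum s) δ₀ n + sumCount (map (x ∷_) ss) n    ≡⟨ cong₂ _+_ (sym (shift-shift x (sum s) δ₀ n))
                                                                      (sumCount-map-∷ x ss n) ⟩
  shift x (shift (sum s) δ₀) n + shift x (sumCount ss) n ≡⟨ sym (shift-⊕ x _ _ n) ⟩
  shift x (shift (sum s) δ₀ ⊕ sumCount ss) n             ≡⟨ sym (shift-cong x (sumCount-∷ s ss) n) ⟩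
  shift x (sumCount (s ∷ ss)) n                          ∎
  where open ≡-Reasoning

partsOf : List ℕ → Series
partsOf []       = δ₀
partsOf (x ∷ xs) = addPart x (partsOf xs)

sumCount-subsets : ∀ xs → sumCount (subsets xs) ≗ partsOf xs
sumCount-subsets []       zero    = refl
sumCount-subsets []       (suc n) = refl
sumCount-subsets (x ∷ xs) n =
  trans (sumCount-++ (subsets xs) (map (x ∷_) (subsets xs)) n)
        (cong₂ _+_ (sumCount-subsets xs n)
                   (trans (sumCount-map-∷ x (subsets xs) n) (shift-cong x (sumCount-subsets xs) n)))

partsOf-∷ʳ : ∀ xs y → partsOf (xs ∷ʳ y) ≗ addPart y (partsOf xs)
partsOf-∷ʳ []       y n = refl
partsOf-∷ʳ (x ∷ xs) y n =
  trans (addPart-cong x (partsOf-∷ʳ xs y) n) (addPart-comm x y (partsOf xs) n)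

partsOf-filter-∷ʳ : ∀ {P : ℕ → Set} (P? : Decidable P) xs y →
  partsOf (filter P? (xs ∷ʳ y)) ≗
  (if does (P? y) then addPart y (partsOf (filter P? xs)) else partsOf (filter P? xs))
partsOf-filter-∷ʳ P? xs y n rewrite filter-++ P? xs (y ∷ []) with does (P? y)
... | true  = partsOf-∷ʳ (filter P? xs) y n
... | false = cong (λ ys → partsOf ys n) (++-identityʳ (filter P? xs))

partsOf-upTo : ∀ {P : ℕ → Set} (P? : Decidable P) M →
               partsOf (filter P? (upTo M)) ≗ parts (does ∘ P?) M
partsOf-upTo P? zero    n = refl
partsOf-upTo P? (suc M) n =
  trans (cong (λ xs → partsOf (filter P? xs) n) (sym (upTo-∷ʳ M)))
        (trans (partsOf-filter-∷ʳ P? (upTo M) M n) (step (does (P? M))))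
  where
  step : ∀ b → (if b then addPart M (partsOf (filter P? (upTo M))) else partsOf (filter P? (upTo M))) n
             ≡ (if b then addPart M (parts (does ∘ P?) M) else parts (does ∘ P?) M) n
  step true  = addPart-cong M (partsOf-upTo P? M) n
  step false = partsOf-upTo P? M n

n<m^n : ∀ {m} → 1 < m → ∀ n → n < m ^ n
n<m^n 1<m zero    = s≤s z≤n
n<m^n {m} 1<m (suc n) = ≤-<-trans (n<m^n 1<m n) (^-monoʳ-< m 1<m (n<1+n n))

-- Uniqueness of binary expansions.
module _ (p : ℕ → Bool) (p[2^j] : ∀ j → p (2 ^ j) ≡ true)
         (p⇒2^j : ∀ {m} → p m ≡ true → ∃[ j ] 2 ^ j ≡ m) where

  private
    p[0] : p 0 ≡ false
    p[0] = ¬-not λ p0 → let j , 2^j≡0 = p⇒2^j p0 in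
      contradiction (subst (0 <_) 2^j≡0 (m^n>0 2 j)) (<-irrefl refl)

    between-powers : ∀ j {m} → 2 ^ j < m → m < 2 ^ suc j → p m ≡ false
    between-powers j {m} 2^j<m m<2^[1+j] = ¬-not λ pm → let i , 2^i≡m = p⇒2^j pm in
      case i ≤? j of λ where
        (yes i≤j) → <⇒≱ 2^j<m (subst (_≤ 2 ^ j) 2^i≡m (^-monoʳ-≤ 2 i≤j))
        (no  i≰j) → <⇒≱ m<2^[1+j] (subst (2 ^ suc j ≤_) 2^i≡m (^-monoʳ-≤ 2 (≰⇒> i≰j)))

    parts-1 : parts p 1 ≡ δ₀
    parts-1 rewrite p[0] = refl

    parts-2^[1+j] : ∀ j → parts p (2 ^ suc j) ≡ addPart (2 ^ j) (parts p (2 ^ j))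
    parts-2^[1+j] j rewrite parts-gap {p} (≤⇒≤′ (^-monoʳ-< 2 ≤-refl (n<1+n j))) (between-powers j)
                          | p[2^j] j = refl

    2^[1+j]≡2^j+2^j : ∀ j → 2 ^ suc j ≡ 2 ^ j + 2 ^ j
    2^[1+j]≡2^j+2^j j = cong (2 ^ j +_) (+-identityʳ (2 ^ j))

    parts-2^j-≥ : ∀ j {n} → 2 ^ j ≤ n → parts p (2 ^ j) n ≡ 0
    parts-2^j-≥ zero {suc n} _ rewrite parts-1 = refl
    parts-2^j-≥ (suc j) {n} 2^[1+j]≤n rewrite parts-2^[1+j] j =
      cong₂ _+_ (parts-2^j-≥ j 2^j≤n) (trans (shift-≥ (parts p (2 ^ j)) 2^j≤n) (parts-2^j-≥ j 2^j≤n∸2^j))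
      where
      2^j≤n     = ≤-trans (m≤m+n (2 ^ j) _) 2^[1+j]≤n
      2^j≤n∸2^j = m+n≤o⇒m≤o∸n (2 ^ j) (subst (_≤ n) (2^[1+j]≡2^j+2^j j) 2^[1+j]≤n)

    parts-2^j-< : ∀ j {n} → n < 2 ^ j → parts p (2 ^ j) n ≡ 1
    parts-2^j-< zero {zero} _ rewrite parts-1 = refl
    parts-2^j-< zero {suc n} (s≤s ())
    parts-2^j-< (suc j) {n} n<2^[1+j] rewrite parts-2^[1+j] j with 2 ^ j ≤? n
    ... | yes 2^j≤n =
      cong₂ _+_ (parts-2^j-≥ j 2^j≤n) (trans (shift-≥ (parts p (2 ^ j)) 2^j≤n) (parts-2^j-< j n∸2^j<2^j))
      where
      n∸2^j<2^j : n ∸ 2 ^ j < 2 ^ j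
      n∸2^j<2^j = subst (n ∸ 2 ^ j <_) (trans (cong (_∸ 2 ^ j) (2^[1+j]≡2^j+2^j j)) (m+n∸m≡n (2 ^ j) (2 ^ j)))
                        (∸-monoˡ-< n<2^[1+j] 2^j≤n)
    ... | no  2^j≰n = cong₂ _+_ (parts-2^j-< j (≰⇒> 2^j≰n)) (shift-< (parts p (2 ^ j)) (≰⇒> 2^j≰n))

  powersOf2-parts≡1 : ∀ {k M} → k < M → parts p M k ≡ 1
  powersOf2-parts≡1 {k} {M} k<M =
    trans (sym (parts-stable p k<M (≤⇒≤′ M≤2^M))) (parts-2^j-< M (<-≤-trans k<M M≤2^M))
    where M≤2^M = <⇒≤ (n<m^n ≤-refl M)

module _ (q : ℕ) .{{_ : NonZero q}} where

  -- a(X^q)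
  dilate : Series → Series
  dilate a n with q ∣? n
  ... | yes _ = a (n / q)
  ... | no  _ = 0

  dilate-cong-≤ : ∀ {a b} n → (∀ {k} → k ≤ n → a k ≡ b k) → dilate a n ≡ dilate b n
  dilate-cong-≤ n a≡b with q ∣? n
  ... | yes _ = a≡b (m/n≤m n q)
  ... | no  _ = refl

  dilate-∤ : ∀ a {n} → ¬ q ∣ n → dilate a n ≡ 0
  dilate-∤ a {n} q∤n with q ∣? n
  ... | yes q∣n = contradiction q∣n q∤n
  ... | no  _   = refl

  dilate-[m*q] : ∀ a m → dilate a (m * q) ≡ a m
  dilate-[m*q] a m with q ∣? m * q
  ... | yes _   = cong a (m*n/n≡m m q)
  ... | no  q∤n = contradiction (n∣m*n m) q∤n

  dilate-δ₀ : dilate δ₀ ≗ δ₀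
  dilate-δ₀ n with q ∣? n
  dilate-δ₀ zero    | yes _   = cong δ₀ (0/n≡0 q)
  dilate-δ₀ (suc n) | yes q∣n with suc n / q | m≥n⇒m/n>0 {suc n} {q} (∣⇒≤ q∣n)
  ... | suc _ | _ = refl
  dilate-δ₀ zero    | no  q∤0 = contradiction (q ∣0) q∤0
  dilate-δ₀ (suc n) | no  _   = refl

  dilate-⊕ : ∀ a b → dilate (a ⊕ b) ≗ dilate a ⊕ dilate b
  dilate-⊕ a b n with q ∣? n
  ... | yes _ = refl
  ... | no  _ = refl

  shift-dilate : ∀ M a → shift (M * q) (dilate a) ≗ dilate (shift M a)
  shift-dilate M a n with M * q ≤? n
  ... | no  n≱Mq = trans (shift-< (dilate a) (≰⇒> n≱Mq)) (sym lhs≡0)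
    where
    lhs≡0 : dilate (shift M a) n ≡ 0
    lhs≡0 with q ∣? n
    ... | yes _ = shift-< a (m<n*o⇒m/o<n {n} {M} (≰⇒> n≱Mq))
    ... | no  _ = refl
  ... | yes Mq≤n rewrite shift-≥ (dilate a) Mq≤n with q ∣? n ∸ M * q | q ∣? n
  ... | yes _       | yes _   = trans (cong a ([m∸n*o]/o≡m/o∸n n M q))
                                    (sym (shift-≥ a (subst (_≤ n / q) (m*n/n≡m M q) (/-monoˡ-≤ q Mq≤n))))
  ... | no  _       | no  _   = refl
  ... | yes q∣n∸Mq  | no  q∤n = contradiction (∣m∸n∣n⇒∣m q Mq≤n q∣n∸Mq (n∣m*n M)) q∤n
  ... | no  q∤n∸Mq  | yes q∣n =
    contradiction (∣m+n∣m⇒∣n (subst (q ∣_) (sym (m+[n∸m]≡n Mq≤n)) q∣n) (n∣m*n M)) q∤n∸Mq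

  dilate-addPart : ∀ M a → dilate (addPart M a) ≗ addPart (M * q) (dilate a)
  dilate-addPart M a n = trans (dilate-⊕ a (shift M a) n) (cong (dilate a n +_) (sym (shift-dilate M a n)))

  parts-dilate : ∀ p M → parts (λ m → does (q ∣? m) ∧ p (m / q)) (M * q) ≗ dilate (parts p M)
  parts-dilate p zero    n = sym (dilate-δ₀ n)
  parts-dilate p (suc M) n = begin
    parts p′ (q + M * q) n     ≡⟨ cong (λ a → a n) (parts-gap (≤⇒≤′ (+-monoˡ-≤ (M * q) 1≤q)) no-multiple) ⟩
    parts p′ (suc (M * q)) n   ≡⟨ cong (λ b → (if b then addPart (M * q) X else X) n) p′[M*q]≡p[M] ⟩
    (if p M then addPart (M * q) X else X) n ≡⟨ step (p M) ⟩
    dilate (parts p (suc M)) n ∎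
    where
    open ≡-Reasoning
    p′ = λ m → does (q ∣? m) ∧ p (m / q)
    X = parts p′ (M * q)
    1≤q = >-nonZero⁻¹ q

    no-multiple : ∀ {m} → suc (M * q) ≤ m → m < q + M * q → p′ m ≡ false
    no-multiple {m} Mq<m m<[1+M]q = cong (_∧ p (m / q)) (dec-false (q ∣? m) q∤m)
      where
      q∤m : ¬ q ∣ m
      q∤m q∣m = <⇒≱ M<m/q (s≤s⁻¹ m/q<1+M)
        where
        m≡[m/q]*q = sym (m/n*n≡m q∣m)
        M<m/q     = *-cancelʳ-< q M (m / q) (subst (M * q <_) m≡[m/q]*q Mq<m)
        m/q<1+M   = *-cancelʳ-< q (m / q) (suc M) (subst (_< suc M * q) m≡[m/q]*q m<[1+M]q)

    p′[M*q]≡p[M] : p′ (M * q) ≡ p M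
    p′[M*q]≡p[M] = cong₂ _∧_ (dec-true (q ∣? M * q) (n∣m*n M)) (cong p (m*n/n≡m M q))

    step : ∀ b → (if b then addPart (M * q) X else X) n
               ≡ dilate (if b then addPart M (parts p M) else parts p M) n
    step true  = trans (addPart-cong (M * q) (parts-dilate p M) n) (sym (dilate-addPart M (parts p M) n))
    step false = parts-dilate p M n

⌈1+n/q⌉≡1+n/q : ∀ q .{{_ : NonZero q}} n → ⌈ suc n / q ⌉ ≡ suc (n / q)
⌈1+n/q⌉≡1+n/q q@(suc k) n = begin
  (suc n + k) / q   ≡⟨ cong (_/ q) (sym (+-suc n k)) ⟩
  (n + q) / q       ≡⟨ +-distrib-/-∣ʳ n (∣-refl {q}) ⟩
  n / q + q / q     ≡⟨ cong (n / q +_) (n/n≡1 q) ⟩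
  n / q + 1         ≡⟨ +-comm (n / q) 1 ⟩
  suc (n / q)       ∎
  where open ≡-Reasoning

⌈1+n/q⌉≡1 : ∀ q .{{_ : NonZero q}} {n} → suc n ≤ q → ⌈ suc n / q ⌉ ≡ 1
⌈1+n/q⌉≡1 q {n} 1+n≤q = trans (⌈1+n/q⌉≡1+n/q q n) (cong suc (m<n⇒m/n≡0 1+n≤q))

⌈m*q/q⌉≡m : ∀ q .{{_ : NonZero q}} m → ⌈ m * q / q ⌉ ≡ m
⌈m*q/q⌉≡m q@(suc k) m = begin
  (m * q + k) / q   ≡⟨ +-distrib-/-∣ˡ k (n∣m*n m) ⟩
  m * q / q + k / q ≡⟨ cong₂ _+_ (m*n/n≡m m q) (m<n⇒m/n≡0 (n<1+n k)) ⟩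
  m + 0             ≡⟨ +-identityʳ m ⟩
  m                 ∎
  where open ≡-Reasoning

[1+n]/q≡n/q : ∀ {q} .{{_ : NonZero q}} n → ¬ q ∣ suc n → suc n / q ≡ n / q
[1+n]/q≡n/q {1}                 n q∤1+n = contradiction (1∣ suc n) q∤1+n
-- For q ≥ 2 the terms 1 % q and 1 / q compute to 1 and 0.
[1+n]/q≡n/q {q@(suc (suc _))} n q∤1+n =
  trans (cong (_/ q) (+-comm 1 n)) (trans (+-distrib-/ n 1 [n%q]+1<q) (+-identityʳ (n / q)))
  where
  open ≡-Reasoning
  [n%q]+1<q : n % q + 1 < q
  [n%q]+1<q = ≤∧≢⇒< (subst (_≤ q) (+-comm 1 (n % q)) (m%n<n n q)) λ [n%q]+1≡q →
    q∤1+n (divides (suc (n / q)) (begin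
      suc n                     ≡⟨ cong suc (m≡m%n+[m/n]*n n q) ⟩
      suc (n % q) + n / q * q   ≡⟨ cong (_+ n / q * q) (trans (+-comm 1 (n % q)) [n%q]+1≡q) ⟩
      q + n / q * q             ∎))

⌈1+n/q⌉≡⌈n/q⌉ : ∀ q .{{_ : NonZero q}} n → ¬ q ∣ n → ⌈ suc n / q ⌉ ≡ ⌈ n / q ⌉
⌈1+n/q⌉≡⌈n/q⌉ q zero    q∤0   = contradiction (q ∣0) q∤0
⌈1+n/q⌉≡⌈n/q⌉ q (suc n) q∤1+n = begin
  ⌈ suc (suc n) / q ⌉ ≡⟨ ⌈1+n/q⌉≡1+n/q q (suc n) ⟩
  suc (suc n / q)     ≡⟨ cong suc ([1+n]/q≡n/q n q∤1+n) ⟩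
  suc (n / q)         ≡⟨ sym (⌈1+n/q⌉≡1+n/q q n) ⟩
  ⌈ suc n / q ⌉       ∎
  where open ≡-Reasoning

at-∷ʳ-< : ∀ xs y {i} → i < length xs → at (xs ∷ʳ y) i ≡ at xs i
at-∷ʳ-< (x ∷ xs) y {zero}  _         = refl
at-∷ʳ-< (x ∷ xs) y {suc i} (s≤s i<n) = at-∷ʳ-< xs y i<n

at-∷ʳ-length : ∀ xs y → at (xs ∷ʳ y) (length xs) ≡ y
at-∷ʳ-length []       y = refl
at-∷ʳ-length (x ∷ xs) y = at-∷ʳ-length xs y

length-hTable : ∀ q n → length (hTable q n) ≡ n
length-hTable q zero    = refl
length-hTable q (suc n) = trans (length-++ (hTable q n)) (trans (cong (_+ 1) (length-hTable q n)) (+-comm n 1))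

h-suc : ∀ q n → h q (suc n) ≡ hStep q n (hTable q n)
h-suc q n = trans (cong (at (hTable q n ∷ʳ _)) (sym (length-hTable q n))) (at-∷ʳ-length (hTable q n) _)

at-hTable : ∀ q {i n} → i < n → at (hTable q n) i ≡ h q (suc i)
at-hTable q {i} {suc n} i<1+n with m<1+n⇒m<n∨m≡n i<1+n
... | inj₁ i<n  = trans (at-∷ʳ-< (hTable q n) _ (subst (i <_) (sym (length-hTable q n)) i<n)) (at-hTable q i<n)
... | inj₂ refl = refl

h-≤q : ∀ q {n} → suc n ≤ q → h q (suc n) ≡ ℕtoℚ (suc n)
h-≤q q {n} 1+n≤q rewrite h-suc q n with suc n ≤? q
... | yes _     = refl
... | no  1+n≰q = contradiction 1+n≤q 1+n≰q

h-suc-∤ : ∀ q {n} → q ≤ n → ¬ q ∣ n → h q (suc n) ≡ h q n +ℚ 1ℚ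
h-suc-∤ q {n} q≤n q∤n rewrite h-suc q n with suc n ≤? q
... | yes 1+n≤q = contradiction 1+n≤q (≤⇒≯ q≤n)
... | no  _ with q ∣? n
...   | yes q∣n = contradiction q∣n q∤n
...   | no  _   = refl

h-suc-∣ : ∀ q .{{_ : NonZero q}} → 1 < q → ∀ {m} → 0 < m →
          h q (suc (m * q)) ≡ h q (m * q) *ℚ (1ℚ - inv (h q (suc m))) +ℚ 1ℚ
h-suc-∣ q 1<q {m} 0<m rewrite h-suc q (m * q) with suc (m * q) ≤? q
... | yes 1+mq≤q = contradiction 1+mq≤q (≤⇒≯ (m≤n*m q m {{>-nonZero 0<m}}))
... | no  _ with q ∣? m * q
...   | no  q∤mq = contradiction (n∣m*n m) q∤mq
...   | yes q∣mq = cong (λ k → h q (m * q) *ℚ (1ℚ - inv k) +ℚ 1ℚ) (at-quotient q∣mq)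
  where
  at-quotient : (q∣mq : q ∣ m * q) → at (hTable q (m * q)) (quotient q∣mq) ≡ h q (suc m)
  at-quotient q∣mq rewrite *-cancelʳ-≡ (quotient q∣mq) m q (sym (_∣_.equality q∣mq)) =
    at-hTable q (m<m*n m q {{>-nonZero 0<m}} 1<q)

ℕtoℚ≡mkℚ : ∀ n → ℕtoℚ n ≡ mkℚ (ℤ.+ n) 0 (Coprimality.sym (Coprimality.1-coprimeTo n))
ℕtoℚ≡mkℚ n = ℚ.normalize-coprime (Coprimality.sym (Coprimality.1-coprimeTo n))

ℕtoℚ-+ : ∀ m n → ℕtoℚ (m + n) ≡ ℕtoℚ m +ℚ ℕtoℚ n
ℕtoℚ-+ m n rewrite ℕtoℚ≡mkℚ m | ℕtoℚ≡mkℚ n =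
  cong (_/ℚ 1) (trans (ℤ.pos-+ m n) (sym (cong₂ ℤ._+_ (ℤ.*-identityʳ (ℤ.+ m)) (ℤ.*-identityʳ (ℤ.+ n)))))

ℕtoℚ-≢0 : ∀ {n} → 0 < n → ℕtoℚ n ≢ 0ℚ
ℕtoℚ-≢0 {suc n} _ rewrite ℕtoℚ≡mkℚ (suc n) = λ ()

inv-*ˡ : ∀ x → x ≢ 0ℚ → inv x *ℚ x ≡ 1ℚ
inv-*ˡ x x≢0 with x ℚ.≟ 0ℚ
... | yes x≡0 = contradiction x≡0 x≢0
... | no  x≢0 = ℚ.*-inverseˡ x {{ℚ.≢-nonZero x≢0}}

h-step-identity : ∀ H K M C → K ≢ 0ℚ → K *ℚ C ≡ M +ℚ C →
                  (H *ℚ (1ℚ - inv K) +ℚ 1ℚ) *ℚ (M +ℚ C) ≡ H *ℚ M +ℚ (M +ℚ C)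
h-step-identity H K M C K≢0 KC≡M+C = begin
  (H *ℚ (1ℚ - I) +ℚ 1ℚ) *ℚ (M +ℚ C)                  ≡⟨ expand H I M C ⟩
  H *ℚ M +ℚ (M +ℚ C) +ℚ H *ℚ (C - I *ℚ (M +ℚ C))     ≡⟨ cong (λ x → H *ℚ M +ℚ (M +ℚ C) +ℚ H *ℚ (C - x))
                                                               I[M+C]≡C ⟩
  H *ℚ M +ℚ (M +ℚ C) +ℚ H *ℚ (C - C)                 ≡⟨ cancel H M C ⟩
  H *ℚ M +ℚ (M +ℚ C)                                 ∎
  where
  open ≡-Reasoning
  open +-*-Solver
  I = inv K
  I[M+C]≡C : I *ℚ (M +ℚ C) ≡ C
  I[M+C]≡C = begin
    I *ℚ (M +ℚ C)   ≡⟨ cong (I *ℚ_) (sym KC≡M+C) ⟩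
    I *ℚ (K *ℚ C)   ≡⟨ sym (ℚ.*-assoc I K C) ⟩
    I *ℚ K *ℚ C     ≡⟨ cong (_*ℚ C) (inv-*ˡ K K≢0) ⟩
    1ℚ *ℚ C         ≡⟨ ℚ.*-identityˡ C ⟩
    C               ∎
  expand = solve 4 (λ H I M C → (H :* (con 1ℚ :- I) :+ con 1ℚ) :* (M :+ C)
                              := H :* M :+ (M :+ C) :+ H :* (C :- I :* (M :+ C))) refl
  cancel = solve 3 (λ H M C → H :* M :+ (M :+ C) :+ H :* (C :- C) := H :* M :+ (M :+ C)) refl

module _ (q : ℕ) (1<q : 1 < q) (q-odd : q % 2 ≡ 1) where

  private instance
    q≢0 : NonZero q
    q≢0 = >-nonZero (<-trans z<s 1<q)

  isTerm⁺ : ∀ {m} a b → 2 ^ a * q ^ b ≡ m → IsTerm q m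
  isTerm⁺ {m} a b refl = applyUpTo⁺ id (applyUpTo⁺ id refl (s≤s b≤m)) (s≤s a≤m)
    where
    a≤m = <⇒≤ (<-≤-trans (n<m^n ≤-refl a) (m≤m*n (2 ^ a) (q ^ b) {{m^n≢0 q b}}))
    b≤m = <⇒≤ (<-≤-trans (n<m^n 1<q b) (m≤n*m (q ^ b) (2 ^ a) {{m^n≢0 2 a}}))

  isTerm⁻ : ∀ {m} → IsTerm q m → ∃₂ λ a b → 2 ^ a * q ^ b ≡ m
  isTerm⁻ t = let a , _ , t′ = applyUpTo⁻ id t ; b , _ , e = applyUpTo⁻ id t′ in a , b , e

  q-coprime-2 : Coprime q 2
  q-coprime-2 {0}                 (0∣q , _) = contradiction (0∣⇒≡0 0∣q) (≢-nonZero⁻¹ q)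
  q-coprime-2 {1}                 _         = refl
  q-coprime-2 {2}                 (2∣q , _) = contradiction (trans (sym q-odd) (n∣m⇒m%n≡0 q 2 2∣q)) λ ()
  q-coprime-2 {suc (suc (suc _))} (_ , i∣2) = contradiction (∣⇒≤ i∣2) λ { (s≤s (s≤s ())) }

  q∤2^j : ∀ j → ¬ q ∣ 2 ^ j
  q∤2^j zero    q∣1   = <⇒≢ 1<q (sym (∣1⇒≡1 q∣1))
  q∤2^j (suc j) q∣2^j = q∤2^j j (coprime-divisor q-coprime-2 q∣2^j)

  2^a*q^[1+b] : ∀ a b → 2 ^ a * q ^ suc b ≡ 2 ^ a * q ^ b * q
  2^a*q^[1+b] a b = trans (cong (2 ^ a *_) (*-comm q (q ^ b))) (sym (*-assoc (2 ^ a) (q ^ b) q))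

  isTerm-∣ : ∀ {m} → q ∣ m → IsTerm q m ⇔ IsTerm q (m / q)
  isTerm-∣ {m} q∣m = mk⇔ to from
    where
    to : IsTerm q m → IsTerm q (m / q)
    to t with isTerm⁻ t
    ... | a , zero  , e = contradiction (subst (q ∣_) (trans (sym e) (*-identityʳ (2 ^ a))) q∣m) (q∤2^j a)
    ... | a , suc b , e = isTerm⁺ a b (trans (sym (m*n/n≡m _ q)) (cong (_/ q) (trans (sym (2^a*q^[1+b] a b)) e)))
    from : IsTerm q (m / q) → IsTerm q m
    from t with isTerm⁻ t
    ... | a , b , e = isTerm⁺ a (suc b) (trans (2^a*q^[1+b] a b) (trans (cong (_* q) e) (m/n*n≡m q∣m)))

  isTerm-∤ : ∀ {m} → IsTerm q m → ¬ q ∣ m → ∃[ j ] 2 ^ j ≡ m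
  isTerm-∤ t q∤m with isTerm⁻ t
  ... | a , zero  , e = a , trans (sym (*-identityʳ (2 ^ a))) e
  ... | a , suc b , e = contradiction (divides (2 ^ a * q ^ b) (trans (sym e) (2^a*q^[1+b] a b))) q∤m

  term multiple powerOf2 : ℕ → Bool
  term     m = does (isTerm? q m)
  multiple m = does (q ∣? m)
  powerOf2 m = term m ∧ not (multiple m)

  powerOf2[2^j] : ∀ j → powerOf2 (2 ^ j) ≡ true
  powerOf2[2^j] j rewrite dec-true (isTerm? q (2 ^ j)) (isTerm⁺ j 0 (*-identityʳ (2 ^ j)))
                        | dec-false (q ∣? 2 ^ j) (q∤2^j j) = refl

  powerOf2⇒2^j : ∀ {m} → powerOf2 m ≡ true → ∃[ j ] 2 ^ j ≡ m
  -- `with isTerm? q m` cannot abstract the decision, which occurs in the goal only in normal form.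
  powerOf2⇒2^j {m} = go (isTerm? q m) (q ∣? m)
    where
    go : (t? : Dec (IsTerm q m)) (q∣?m : Dec (q ∣ m)) → does t? ∧ not (does q∣?m) ≡ true → ∃[ j ] 2 ^ j ≡ m
    go (yes t) (no q∤m) _ = isTerm-∤ t q∤m

  term∧multiple≗ : (λ m → term m ∧ multiple m) ≗ (λ m → multiple m ∧ term (m / q))
  term∧multiple≗ m with q ∣? m
  ... | yes q∣m = trans (∧-identityʳ (term m)) (does-⇔ (isTerm-∣ q∣m) (isTerm? q m) (isTerm? q (m / q)))
  ... | no  _   = ∧-zeroʳ (term m)

  f≡parts : ∀ {n M} → n < M → f q n ≡ parts term M n
  f≡parts {n} n<M = trans (sumCount-subsets (termsUpTo q n) n)
                   (trans (partsOf-upTo (isTerm? q) (suc n) n) (sym (parts-stable term (n<1+n n) (≤⇒≤′ n<M))))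

  f≗ones⋆dilate[f] : f q ≗ ones ⋆ dilate q (f q)
  f≗ones⋆dilate[f] n = begin
    f q n                                                    ≡⟨ f≡parts (n<1+n n) ⟩
    parts term M n                                           ≡⟨ parts-split term multiple M n ⟩
    (parts powerOf2 M ⋆ parts (λ m → term m ∧ multiple m) M) n ≡⟨ ⋆-cong-≤ n parts[powerOf2]≡1
                                                                           parts[multiple]≡dilate ⟩
    (ones ⋆ dilate q (f q)) n                                ∎
    where
    open ≡-Reasoning
    M = suc n

    parts[powerOf2]≡1 : ∀ {k} → k ≤ n → parts powerOf2 M k ≡ 1
    parts[powerOf2]≡1 k≤n = powersOf2-parts≡1 powerOf2 powerOf2[2^j] powerOf2⇒2^j (s≤s k≤n)

    parts[multiple]≡dilate : ∀ {k} → k ≤ n → parts (λ m → term m ∧ multiple m) M k ≡ dilate q (f q) k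
    parts[multiple]≡dilate {k} k≤n = begin
      parts (λ m → term m ∧ multiple m) M k  ≡⟨ cong (λ a → a k) (parts-cong term∧multiple≗ M) ⟩
      parts p′ M k                           ≡⟨ sym (parts-stable p′ (s≤s k≤n) (≤⇒≤′ (m≤m*n M q))) ⟩
      parts p′ (M * q) k                     ≡⟨ parts-dilate q term M k ⟩
      dilate q (parts term M) k              ≡⟨ dilate-cong-≤ q k (λ j≤k → sym (f≡parts (s≤s (≤-trans j≤k k≤n)))) ⟩
      dilate q (f q) k                       ∎
      where p′ = λ m → multiple m ∧ term (m / q)

  f-suc : ∀ n → f q (suc n) ≡ f q n + dilate q (f q) (suc n)
  f-suc n = begin
    f q (suc n)                                            ≡⟨ f≗ones⋆dilate[f] (suc n) ⟩
    1 * dilate q (f q) (suc n) + (ones ⋆ dilate q (f q)) n ≡⟨ cong₂ _+_ (*-identityˡ _) (sym (f≗ones⋆dilate[f] n)) ⟩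
    dilate q (f q) (suc n) + f q n                         ≡⟨ +-comm _ (f q n) ⟩
    f q n + dilate q (f q) (suc n)                         ∎
    where open ≡-Reasoning

  f-pos : ∀ n → 0 < f q n
  f-pos zero    = z<s
  f-pos (suc n) = <-≤-trans (f-pos n) (subst (f q n ≤_) (sym (f-suc n)) (m≤m+n _ _))

  f-block : ∀ i {r} → r < q → f q (i * q + r) ≡ f q (i * q)
  f-block i {zero}  _     = cong (f q) (+-identityʳ (i * q))
  f-block i {suc r} 1+r<q = begin
    f q (i * q + suc r)                                 ≡⟨ cong (f q) (+-suc (i * q) r) ⟩
    f q (suc (i * q + r))                               ≡⟨ f-suc (i * q + r) ⟩
    f q (i * q + r) + dilate q (f q) (suc (i * q + r))  ≡⟨ cong (f q (i * q + r) +_) (dilate-∤ q (f q) q∤) ⟩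
    f q (i * q + r) + 0                                 ≡⟨ +-identityʳ _ ⟩
    f q (i * q + r)                                     ≡⟨ f-block i (<-trans (n<1+n r) 1+r<q) ⟩
    f q (i * q)                                         ∎
    where
    open ≡-Reasoning
    q∤ : ¬ q ∣ suc (i * q + r)
    q∤ q∣ = <⇒≱ 1+r<q (∣⇒≤ (∣m+n∣m⇒∣n (subst (q ∣_) (sym (+-suc (i * q) r)) q∣) (n∣m*n i)))

  f[n*q]≡g[1+n] : ∀ n → f q (n * q) ≡ g q (suc n)
  f[n*q]≡g[1+n] n = sym (trans (cong (f q) q*[1+n]∸1≡n*q+[q∸1]) (f-block n (≤-reflexive (m+[n∸m]≡n 1≤q))))
    where
    1≤q = <⇒≤ 1<q
    q*[1+n]∸1≡n*q+[q∸1] : q * suc n ∸ 1 ≡ n * q + (q ∸ 1)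
    q*[1+n]∸1≡n*q+[q∸1] =
      trans (cong (_∸ 1) (*-comm q (suc n))) (trans (+-∸-comm (n * q) 1≤q) (+-comm (q ∸ 1) (n * q)))

  f≡g[1+n/q] : ∀ n → f q n ≡ g q (suc (n / q))
  f≡g[1+n/q] n = begin
    f q n                   ≡⟨ cong (f q) (trans (m≡m%n+[m/n]*n n q) (+-comm (n % q) _)) ⟩
    f q (n / q * q + n % q) ≡⟨ f-block (n / q) (m%n<n n q) ⟩
    f q (n / q * q)         ≡⟨ f[n*q]≡g[1+n] (n / q) ⟩
    g q (suc (n / q))       ∎
    where open ≡-Reasoning

  g-rec : ∀ {n} → 0 < n → g q (suc n) ≡ g q n + g q ⌈ suc n / q ⌉
  g-rec {n} 0<n = begin
    g q (suc n)                                         ≡⟨ sym (f[n*q]≡g[1+n] n) ⟩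
    f q (n * q)                                         ≡⟨ cong (f q) (sym 1+[nq∸1]≡nq) ⟩
    f q (suc (n * q ∸ 1))                               ≡⟨ f-suc (n * q ∸ 1) ⟩
    f q (n * q ∸ 1) + dilate q (f q) (suc (n * q ∸ 1))  ≡⟨ cong₂ _+_ (cong (λ m → f q (m ∸ 1)) (*-comm n q))
                                                                     (cong (dilate q (f q)) 1+[nq∸1]≡nq) ⟩
    g q n + dilate q (f q) (n * q)                      ≡⟨ cong (g q n +_) (trans (dilate-[m*q] q (f q) n) (f≡g[1+n/q] n)) ⟩
    g q n + g q (suc (n / q))                           ≡⟨ cong (λ c → g q n + g q c) (sym (⌈1+n/q⌉≡1+n/q q n)) ⟩
    g q n + g q ⌈ suc n / q ⌉                           ∎
    where
    open ≡-Reasoning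
    1+[nq∸1]≡nq : suc (n * q ∸ 1) ≡ n * q
    1+[nq∸1]≡nq = m+[n∸m]≡n (<-≤-trans 0<n (m≤m*n n q))

  g-pos : ∀ n → 0 < g q n
  g-pos n = f-pos (q * n ∸ 1)

  g-≤q : ∀ {n} → suc n ≤ q → g q (suc n) ≡ suc n
  g-≤q {zero}  _     = sym (f[n*q]≡g[1+n] 0)
  g-≤q {suc n} 2+n≤q = begin
    g q (suc (suc n))                        ≡⟨ g-rec z<s ⟩
    g q (suc n) + g q ⌈ suc (suc n) / q ⌉    ≡⟨ cong₂ _+_ (g-≤q (<⇒≤ 2+n≤q)) (cong (g q) (⌈1+n/q⌉≡1 q 2+n≤q)) ⟩
    suc n + g q 1                            ≡⟨ cong (suc n +_) (g-≤q (<⇒≤ 1<q)) ⟩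
    suc n + 1                                ≡⟨ +-comm (suc n) 1 ⟩
    suc (suc n)                              ∎
    where open ≡-Reasoning

  G : ℕ → ℚ
  G n = ℕtoℚ (g q n)

  h·g≡g : ℕ → Set
  h·g≡g n = h q n *ℚ G ⌈ n / q ⌉ ≡ G n

  h·g≡g-small : ∀ {n} → suc n ≤ q → h·g≡g (suc n)
  h·g≡g-small {n} 1+n≤q = begin
    h q (suc n) *ℚ G ⌈ suc n / q ⌉  ≡⟨ cong₂ _*ℚ_ (h-≤q q 1+n≤q) (cong G (⌈1+n/q⌉≡1 q 1+n≤q)) ⟩
    ℕtoℚ (suc n) *ℚ G 1             ≡⟨ cong (λ k → ℕtoℚ (suc n) *ℚ ℕtoℚ k) (g-≤q (<⇒≤ 1<q)) ⟩
    ℕtoℚ (suc n) *ℚ 1ℚ              ≡⟨ ℚ.*-identityʳ _ ⟩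
    ℕtoℚ (suc n)                    ≡⟨ cong ℕtoℚ (sym (g-≤q 1+n≤q)) ⟩
    G (suc n)                       ∎
    where open ≡-Reasoning

  h·g≡g-suc-∤ : ∀ {n} → q ≤ n → ¬ q ∣ n → h·g≡g n → h·g≡g (suc n)
  h·g≡g-suc-∤ {n} q≤n q∤n h·g≡g[n] = begin
    h q (suc n) *ℚ G c           ≡⟨ cong (_*ℚ G c) (h-suc-∤ q q≤n q∤n) ⟩
    (h q n +ℚ 1ℚ) *ℚ G c         ≡⟨ ℚ.*-distribʳ-+ (G c) (h q n) 1ℚ ⟩
    h q n *ℚ G c +ℚ 1ℚ *ℚ G c    ≡⟨ cong₂ _+ℚ_ (cong (λ k → h q n *ℚ G k) (⌈1+n/q⌉≡⌈n/q⌉ q n q∤n))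
                                              (ℚ.*-identityˡ (G c)) ⟩
    h q n *ℚ G ⌈ n / q ⌉ +ℚ G c  ≡⟨ cong (_+ℚ G c) h·g≡g[n] ⟩
    G n +ℚ G c                   ≡⟨ sym (ℕtoℚ-+ (g q n) (g q c)) ⟩
    ℕtoℚ (g q n + g q c)         ≡⟨ cong ℕtoℚ (sym (g-rec (<-≤-trans (<-trans z<s 1<q) q≤n))) ⟩
    G (suc n)                    ∎
    where
    open ≡-Reasoning
    c = ⌈ suc n / q ⌉

  h·g≡g-suc-∣ : ∀ {m} → 0 < m → h·g≡g (m * q) → h·g≡g (suc m) → h·g≡g (suc (m * q))
  h·g≡g-suc-∣ {m} 0<m h·g≡g[mq] h·g≡g[1+m] = begin
    h q (suc (m * q)) *ℚ G ⌈ suc (m * q) / q ⌉  ≡⟨ cong₂ _*ℚ_ (h-suc-∣ q 1<q 0<m) (cong G ⌈1+mq/q⌉≡1+m) ⟩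
    (H *ℚ (1ℚ - inv K) +ℚ 1ℚ) *ℚ G (suc m)      ≡⟨ cong ((H *ℚ (1ℚ - inv K) +ℚ 1ℚ) *ℚ_) G[1+m]≡G[m]+C ⟩
    (H *ℚ (1ℚ - inv K) +ℚ 1ℚ) *ℚ (G m +ℚ C)     ≡⟨ h-step-identity H K (G m) C K≢0
                                                                     (trans h·g≡g[1+m] G[1+m]≡G[m]+C) ⟩
    H *ℚ G m +ℚ (G m +ℚ C)                      ≡⟨ cong₂ _+ℚ_ h·g≡g[mq]′ (sym G[1+m]≡G[m]+C) ⟩
    G (m * q) +ℚ G (suc m)                      ≡⟨ sym (ℕtoℚ-+ (g q (m * q)) (g q (suc m))) ⟩
    ℕtoℚ (g q (m * q) + g q (suc m))            ≡⟨ cong ℕtoℚ (sym g[1+mq]) ⟩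
    G (suc (m * q))                             ∎
    where
    open ≡-Reasoning
    H = h q (m * q)
    K = h q (suc m)
    C = G ⌈ suc m / q ⌉

    ⌈1+mq/q⌉≡1+m : ⌈ suc (m * q) / q ⌉ ≡ suc m
    ⌈1+mq/q⌉≡1+m = trans (⌈1+n/q⌉≡1+n/q q (m * q)) (cong suc (m*n/n≡m m q))

    h·g≡g[mq]′ : H *ℚ G m ≡ G (m * q)
    h·g≡g[mq]′ = trans (cong (λ k → H *ℚ G k) (sym (⌈m*q/q⌉≡m q m))) h·g≡g[mq]

    G[1+m]≡G[m]+C : G (suc m) ≡ G m +ℚ C
    G[1+m]≡G[m]+C = trans (cong ℕtoℚ (g-rec 0<m)) (ℕtoℚ-+ (g q m) _)

    g[1+mq] : g q (suc (m * q)) ≡ g q (m * q) + g q (suc m)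
    g[1+mq] = trans (g-rec (<-≤-trans 0<m (m≤m*n m q))) (cong (λ k → g q (m * q) + g q k) ⌈1+mq/q⌉≡1+m)

    K≢0 : K ≢ 0ℚ
    K≢0 K≡0 = ℕtoℚ-≢0 (g-pos (suc m)) (begin
      G (suc m)  ≡⟨ sym h·g≡g[1+m] ⟩
      K *ℚ C     ≡⟨ cong (_*ℚ C) K≡0 ⟩
      0ℚ *ℚ C    ≡⟨ ℚ.*-zeroˡ C ⟩
      0ℚ         ∎)

  h[n]·g[⌈n/q⌉]≡g[n] : ∀ n → 0 < n → h·g≡g n
  h[n]·g[⌈n/q⌉]≡g[n] = <-rec (λ n → 0 < n → h·g≡g n) step
    where
    step : ∀ n → (∀ {m} → m < n → 0 < m → h·g≡g m) → 0 < n → h·g≡g n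
    -- Splitting with `with` instead would make Agda normalise h and g in the goal.
    step (suc n) rec _ = by-cases (q ≤? n) (q ∣? n)
      where
      0<q = <-trans z<s 1<q
      0<n = λ (q≤n : q ≤ n) → <-≤-trans 0<q q≤n

      by-cases : Dec (q ≤ n) → Dec (q ∣ n) → h·g≡g (suc n)
      by-cases (no  q≰n) _                                = h·g≡g-small (≰⇒> q≰n)
      by-cases (yes q≤n) (no q∤n)                         = h·g≡g-suc-∤ q≤n q∤n (rec {n} ≤-refl (0<n q≤n))
      by-cases (yes q≤n) (yes (divides zero n≡0))         = contradiction (subst (q ≤_) n≡0 q≤n) (<⇒≱ 0<q)
      by-cases (yes q≤n) (yes (divides (suc m) n≡[1+m]q)) = subst (h·g≡g ∘ suc) (sym n≡[1+m]q)
        (h·g≡g-suc-∣ {suc m} z<s (subst h·g≡g n≡[1+m]q (rec {n} ≤-refl (0<n q≤n)))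
                                 (rec {suc (suc m)} (s≤s 1+m<n) z<s))
        where 1+m<n = subst (suc m <_) (sym n≡[1+m]q) (m<m*n (suc m) q 1<q)

lemma5 : (q : ℕ) → 3 ≤ q → q % 2 ≡ 1 →
         (n : ℕ) → 1 ≤ n →
         h q n *ℚ ℕtoℚ (g q ⌈ n / q ⌉) ≤ℚ ℕtoℚ (g q n)
lemma5 q 3≤q q-odd n 0<n = ℚ.≤-reflexive (h[n]·g[⌈n/q⌉]≡g[n] q 1<q q-odd n 0<n)
  where 1<q = <-≤-trans (s≤s (s≤s z≤n)) 3≤q
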